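{- Let $T = \{\, \overline{\times}_{i=1}^{n} C_5 \mid n \in \mathbb{N},\ n\ge 1 \,\}$, where $\overline{\times}_{i=1}^{n} C_5$ denotes the iterated complementary direct product of $n$ copies of $C_5$, and let $\mathcal{R}$ be the class of $C_5$-reseminant graphs. Then, up to isomorphism, $T \cap \mathcal{R} = \{C_5\}$.
   Context: All graphs are finite, simple and undirected; $\overline{G}$ denotes the complement of $G$. The direct (tensor) product $G\times H$ has vertex set $V(G)\times V(H)$, with $\{(x,y),(x',y')\}$ an edge iff $\{x,x'\}\in E(G)$ and $\{y,y'\}\in E(H)$. The complementary direct product is $G\,\overline{\times}\,H = \overline{\overline{G}\times\overline{H}}$, iterated as $\overline{\times}_{i=1}^{n}\Gamma_i = (\overline{\times}_{i=1}^{n-1}\Gamma_i)\,\overline{\times}\,\Gamma_n$. $C_5$ is the 5-cycle. For a vertex $w$, $N_1[w]$ is its closed neighborhood. Vertex duplication of $w$ adds a new vertex $w'$ adjacent exactly to the vertices of $N_1[w]$. A $C_5$-reseminant graph is a graph obtained from $C_5$ by a finite number (possibly zero) of vertex duplications. -}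

module Defs where

open import Level using (0ℓ)
open import Data.Nat using (ℕ; zero; suc; _+_; _*_; _%_; NonZero)
open import Data.Fin using (Fin; zero; suc; toℕ; quotient; remainder)
open import Data.Product using (Σ; _×_; _,_; proj₁; proj₂; swap)
open import Data.Sum using (_⊎_; inj₁; inj₂)
open import Data.Empty using (⊥)
open import Relation.Nullary using (¬_)
open import Relation.Binary.PropositionalEquality using (_≡_; _≢_; refl; sym)
open import Function.Bundles using (_↔_; Inverse)

record Graph : Set₁ where
  field
    size  : ℕ
    Adj   : Fin size → Fin size → Set
    symm  : ∀ {x y} → Adj x y → Adj y x
    irrfl : ∀ {x} → ¬ Adj x x
open Graph public

record _≅_ (G H : Graph) : Set where
  field
    bij  : Fin (size G) ↔ Fin (size H)
    pres : ∀ x y → Adj G x y → Adj H (Inverse.to bij x) (Inverse.to bij y)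
    reflect : ∀ x y → Adj H (Inverse.to bij x) (Inverse.to bij y) → Adj G x y
infix 4 _≅_

complement : Graph → Graph
complement G = record
  { size = size G
  ; Adj = λ x y → x ≢ y × ¬ Adj G x y
  ; symm = λ { (x≢y , ¬a) → (λ e → x≢y (sym e)) , (λ a → ¬a (symm G a)) }
  ; irrfl = λ { (x≢x , _) → x≢x refl }
  }

-- Direct (tensor) product; the vertex set Fin (m * n) is identified with
-- Fin m × Fin n via the bijection (quotient, remainder) of the stdlib.
_×ᵍ_ : Graph → Graph → Graph
G ×ᵍ H = record
  { size = size G * size H
  ; Adj = λ p q → Adj G (quotient (size H) p) (quotient (size H) q)
                × Adj H (remainder {size G} (size H) p) (remainder {size G} (size H) q)
  ; symm = λ { (a , b) → symm G a , symm H b }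
  ; irrfl = λ { (a , _) → irrfl G a }
  }

_×̄_ : Graph → Graph → Graph
G ×̄ H = complement (complement G ×ᵍ complement H)

C5 : Graph
C5 = record
  { size = 5
  ; Adj = λ i j → (toℕ j ≡ (toℕ i + 1) % 5) ⊎ (toℕ i ≡ (toℕ j + 1) % 5)
  ; symm = λ { (inj₁ e) → inj₂ e ; (inj₂ e) → inj₁ e }
  ; irrfl = irr
  }
  where
  irr : ∀ {x : Fin 5} → ¬ ((toℕ x ≡ (toℕ x + 1) % 5) ⊎ (toℕ x ≡ (toℕ x + 1) % 5))
  irr {zero} (inj₁ ())
  irr {zero} (inj₂ ())
  irr {suc zero} (inj₁ ())
  irr {suc zero} (inj₂ ())
  irr {suc (suc zero)} (inj₁ ())
  irr {suc (suc zero)} (inj₂ ())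
  irr {suc (suc (suc zero))} (inj₁ ())
  irr {suc (suc (suc zero))} (inj₂ ())
  irr {suc (suc (suc (suc zero)))} (inj₁ ())
  irr {suc (suc (suc (suc zero)))} (inj₂ ())

C5-power : (n : ℕ) → .{{NonZero n}} → Graph
C5-power (suc zero) = C5
C5-power (suc (suc n)) = C5-power (suc n) ×̄ C5

-- Vertex duplication of w: the new vertex is `zero`, old vertex x becomes `suc x`;
-- the new vertex is adjacent exactly to the vertices of N₁[w] = {w} ∪ N(w).
duplicate : (G : Graph) → Fin (size G) → Graph
duplicate G w = record
  { size = suc (size G)
  ; Adj = A
  ; symm = λ {x} {y} → s {x} {y}
  ; irrfl = λ {x} → i {x}
  }
  where
  A : Fin (suc (size G)) → Fin (suc (size G)) → Set
  A zero zero = ⊥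
  A zero (suc y) = (y ≡ w) ⊎ Adj G w y
  A (suc x) zero = (x ≡ w) ⊎ Adj G w x
  A (suc x) (suc y) = Adj G x y
  s : ∀ {x y} → A x y → A y x
  s {zero} {suc y} a = a
  s {suc x} {zero} a = a
  s {suc x} {suc y} a = symm G a
  i : ∀ {x} → ¬ A x x
  i {suc x} a = irrfl G a

data Reseminant : Graph → Set₁ where
  base : Reseminant C5
  dup  : ∀ {G} → Reseminant G → (w : Fin (size G)) → Reseminant (duplicate G w)

{-# OPTIONS --safe #-}
-- Call two distinct vertices twins when they have the same closed neighbourhood.
-- Duplicating a vertex creates a pair of twins, so every C5-reseminant graph other
-- than C5 has twins.  On the other hand C5 is twin-free and has no dominating vertex,
-- and both properties pass to G ×̄ H, because the closed neighbourhood of (a , b) in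
-- G ×̄ H is N₁[a] × V(H) ∪ V(G) × N₁[b]: a vertex separating a from a′ in G, paired
-- with a non-neighbour of b′ in H, separates (a , b) from (a′ , b′).  Hence every
-- C5-power is twin-free, and only C5 itself lies in both classes.
module Submission where

open import Defs
open import Data.Nat as ℕ using (ℕ; NonZero; suc)
open import Data.Fin using (Fin; zero; suc; toℕ; combine; quotient; remainder; _≟_)
open import Data.Fin.Properties using (remQuot-combine; combine-remQuot; suc-injective; all?; any?)
open import Data.Product as Product using (Σ; _×_; ∃-syntax; _,_; proj₁; proj₂)
open import Data.Sum as Sum using (_⊎_; inj₁; inj₂)
open import Data.Empty using (⊥-elim)
open import Function using (_∘_)
open import Function.Bundles using (_⇔_; mk⇔; Inverse)
open import Function.Construct.Symmetry using (↔-sym)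
open import Relation.Nullary using (¬_; Dec; ¬?; yes; no)
open import Relation.Nullary.Decidable using (_×-dec_; _⊎-dec_; _→-dec_; from-yes)
open import Relation.Binary.PropositionalEquality
  using (_≡_; _≢_; refl; sym; trans; cong; cong₂; subst; subst₂; ≢-sym; module ≡-Reasoning)

N₁ : (G : Graph) → Fin (size G) → Fin (size G) → Set
N₁ G x z = z ≡ x ⊎ Adj G x z

Separates : (G : Graph) → Fin (size G) → Fin (size G) → Fin (size G) → Set
Separates G z x y = N₁ G x z × ¬ N₁ G y z

Separated : (G : Graph) → Fin (size G) → Fin (size G) → Set
Separated G x y = ∃[ z ] (Separates G z x y ⊎ Separates G z y x)

TwinFree : Graph → Set
TwinFree G = ∀ x y → x ≢ y → Separated G x y

NoDominatingVertex : Graph → Set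
NoDominatingVertex G = ∀ x → ∃[ z ] ¬ N₁ G x z

N₁⇒¬complement-Adj : ∀ {G x z} → N₁ G x z → ¬ Adj (complement G) x z
N₁⇒¬complement-Adj (inj₁ refl) (x≢x , _) = x≢x refl
N₁⇒¬complement-Adj (inj₂ xz)   (_ , ¬xz) = ¬xz xz

¬N₁⇒complement-Adj : ∀ {G x z} → ¬ N₁ G x z → Adj (complement G) x z
¬N₁⇒complement-Adj ¬N₁xz = (λ x≡z → ¬N₁xz (inj₁ (sym x≡z))) , ¬N₁xz ∘ inj₂

¬twinFree-duplicate : (G : Graph) (w : Fin (size G)) → ¬ TwinFree (duplicate G w)
¬twinFree-duplicate G w twinFree with twinFree zero (suc w) (λ ())
... | z , inj₁ (N₁copy , ¬N₁w) = ¬N₁w (copy⊆original z N₁copy)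
  where
  copy⊆original : ∀ z → N₁ (duplicate G w) zero z → N₁ (duplicate G w) (suc w) z
  copy⊆original zero    _                  = inj₂ (inj₁ refl)
  copy⊆original (suc v) (inj₂ (inj₁ v≡w)) = inj₁ (cong suc v≡w)
  copy⊆original (suc v) (inj₂ (inj₂ wv))  = inj₂ wv
... | z , inj₂ (N₁w , ¬N₁copy) = ¬N₁copy (original⊆copy z N₁w)
  where
  original⊆copy : ∀ z → N₁ (duplicate G w) (suc w) z → N₁ (duplicate G w) zero z
  original⊆copy zero    _          = inj₁ refl
  original⊆copy (suc v) (inj₁ v≡w) = inj₂ (inj₁ (suc-injective v≡w))
  original⊆copy (suc v) (inj₂ wv)  = inj₂ (inj₂ wv)

≅-sym : ∀ {G H} → G ≅ H → H ≅ G
≅-sym {G} {H} i = record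
  { bij     = ↔-sym bij
  ; pres    = λ x y xy → reflect (from x) (from y) (subst₂ (Adj H) (sym (strictlyInverseˡ x)) (sym (strictlyInverseˡ y)) xy)
  ; reflect = λ x y xy → subst₂ (Adj H) (strictlyInverseˡ x) (strictlyInverseˡ y) (pres (from x) (from y) xy)
  }
  where
  open _≅_ i
  open Inverse bij

module _ {G H : Graph} (i : G ≅ H) where
  open _≅_ i
  open Inverse bij

  N₁-to : ∀ {x z} → N₁ G x z → N₁ H (to x) (to z)
  N₁-to (inj₁ refl) = inj₁ refl
  N₁-to (inj₂ xz)   = inj₂ (pres _ _ xz)

  N₁-from : ∀ {x z} → N₁ H (to x) (to z) → N₁ G x z
  N₁-from {x} {z} (inj₁ tz≡tx) =
    inj₁ (trans (sym (strictlyInverseʳ z)) (trans (cong from tz≡tx) (strictlyInverseʳ x)))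
  N₁-from (inj₂ xz) = inj₂ (reflect _ _ xz)

  separates-to : ∀ {x y z} → Separates G z (from x) (from y) → Separates H (to z) x y
  separates-to {x} {y} {z} (N₁xz , ¬N₁yz) =
    subst (λ a → N₁ H a (to z)) (strictlyInverseˡ x) (N₁-to N₁xz) ,
    ¬N₁yz ∘ N₁-from ∘ subst (λ a → N₁ H a (to z)) (sym (strictlyInverseˡ y))

  twinFree-≅ : TwinFree G → TwinFree H
  twinFree-≅ twinFree x y x≢y =
    Product.map to (Sum.map separates-to separates-to) (twinFree (from x) (from y) from-x≢from-y)
    where
    from-x≢from-y : from x ≢ from y
    from-x≢from-y e = x≢y (trans (sym (strictlyInverseˡ x)) (trans (cong to e) (strictlyInverseˡ y)))

module ComplementaryProduct (G H : Graph) where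
  private
    P : Graph
    P = G ×̄ H

    π₁ : Fin (size P) → Fin (size G)
    π₁ = quotient (size H)

    π₂ : Fin (size P) → Fin (size H)
    π₂ = remainder {size G} (size H)

  N₁-×̄ : ∀ {p z} → N₁ G (π₁ p) (π₁ z) ⊎ N₁ H (π₂ p) (π₂ z) → N₁ P p z
  N₁-×̄ {p} {z} N₁pz with z ≟ p
  ... | yes z≡p = inj₁ z≡p
  ... | no  z≢p = inj₂ (≢-sym z≢p , λ (Ḡpz , H̄pz) →
                    Sum.[ (λ N₁Gpz → N₁⇒¬complement-Adj {G} N₁Gpz Ḡpz) ,
                          (λ N₁Hpz → N₁⇒¬complement-Adj {H} N₁Hpz H̄pz) ] N₁pz)

  ¬N₁-×̄ : ∀ {p z} → ¬ N₁ G (π₁ p) (π₁ z) → ¬ N₁ H (π₂ p) (π₂ z) → ¬ N₁ P p z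
  ¬N₁-×̄ ¬N₁Gpz ¬N₁Hpz (inj₁ refl)     = ¬N₁Gpz (inj₁ refl)
  ¬N₁-×̄ ¬N₁Gpz ¬N₁Hpz (inj₂ (_ , ¬pz)) = ¬pz (¬N₁⇒complement-Adj {G} ¬N₁Gpz , ¬N₁⇒complement-Adj {H} ¬N₁Hpz)

  private
    at-combine : ∀ c d (Q : Fin (size G) × Fin (size H) → Set) → Q (c , d) →
                 Q (π₁ (combine c d) , π₂ (combine c d))
    at-combine c d Q = subst Q (sym (remQuot-combine c d))

  N₁-combine : ∀ {p} c d → N₁ G (π₁ p) c ⊎ N₁ H (π₂ p) d → N₁ P p (combine c d)
  N₁-combine {p} c d N₁pcd =
    N₁-×̄ (at-combine c d (λ cd → N₁ G (π₁ p) (proj₁ cd) ⊎ N₁ H (π₂ p) (proj₂ cd)) N₁pcd)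

  ¬N₁-combine : ∀ {p} c d → ¬ N₁ G (π₁ p) c → ¬ N₁ H (π₂ p) d → ¬ N₁ P p (combine c d)
  ¬N₁-combine {p} c d ¬N₁pc ¬N₁pd =
    ¬N₁-×̄ (at-combine c d (λ cd → ¬ N₁ G (π₁ p) (proj₁ cd)) ¬N₁pc)
          (at-combine c d (λ cd → ¬ N₁ H (π₂ p) (proj₂ cd)) ¬N₁pd)

  noDominatingVertex-×̄ : NoDominatingVertex G → NoDominatingVertex H → NoDominatingVertex P
  noDominatingVertex-×̄ noDomG noDomH p with noDomG (π₁ p) | noDomH (π₂ p)
  ... | c , ¬N₁pc | d , ¬N₁pd = combine c d , ¬N₁-combine c d ¬N₁pc ¬N₁pd

  module _ (noDomG : NoDominatingVertex G) (noDomH : NoDominatingVertex H) where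
    separated-by-G : ∀ {x y} → Separated G (π₁ x) (π₁ y) → Separated P x y
    separated-by-G {x} {y} (c , inj₁ (N₁xc , ¬N₁yc)) =
      let d , ¬N₁yd = noDomH (π₂ y) in
      combine c d , inj₁ (N₁-combine c d (inj₁ N₁xc) , ¬N₁-combine c d ¬N₁yc ¬N₁yd)
    separated-by-G {x} {y} (c , inj₂ (N₁yc , ¬N₁xc)) =
      let d , ¬N₁xd = noDomH (π₂ x) in
      combine c d , inj₂ (N₁-combine c d (inj₁ N₁yc) , ¬N₁-combine c d ¬N₁xc ¬N₁xd)

    separated-by-H : ∀ {x y} → Separated H (π₂ x) (π₂ y) → Separated P x y
    separated-by-H {x} {y} (d , inj₁ (N₁xd , ¬N₁yd)) =
      let c , ¬N₁yc = noDomG (π₁ y) in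
      combine c d , inj₁ (N₁-combine c d (inj₂ N₁xd) , ¬N₁-combine c d ¬N₁yc ¬N₁yd)
    separated-by-H {x} {y} (d , inj₂ (N₁yd , ¬N₁xd)) =
      let c , ¬N₁xc = noDomG (π₁ x) in
      combine c d , inj₂ (N₁-combine c d (inj₂ N₁yd) , ¬N₁-combine c d ¬N₁xc ¬N₁xd)

    twinFree-×̄ : TwinFree G → TwinFree H → TwinFree P
    twinFree-×̄ twinFreeG twinFreeH x y x≢y with π₁ x ≟ π₁ y | π₂ x ≟ π₂ y
    ... | no π₁x≢π₁y | _          = separated-by-G (twinFreeG _ _ π₁x≢π₁y)
    ... | yes _      | no π₂x≢π₂y = separated-by-H (twinFreeH _ _ π₂x≢π₂y)
    ... | yes π₁x≡π₁y | yes π₂x≡π₂y = ⊥-elim (x≢y (begin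
      x                      ≡⟨ combine-remQuot {size G} (size H) x ⟨
      combine (π₁ x) (π₂ x)  ≡⟨ cong₂ combine π₁x≡π₁y π₂x≡π₂y ⟩
      combine (π₁ y) (π₂ y)  ≡⟨ combine-remQuot {size G} (size H) y ⟩
      y                      ∎))
      where open ≡-Reasoning

module _ (G : Graph) (Adj? : ∀ x y → Dec (Adj G x y)) where
  N₁? : ∀ x z → Dec (N₁ G x z)
  N₁? x z = z ≟ x ⊎-dec Adj? x z

  separates? : ∀ z x y → Dec (Separates G z x y)
  separates? z x y = N₁? x z ×-dec ¬? (N₁? y z)

  twinFree? : Dec (TwinFree G)
  twinFree? = all? λ x → all? λ y → ¬? (x ≟ y) →-dec any? λ z → separates? z x y ⊎-dec separates? z y x

  noDominatingVertex? : Dec (NoDominatingVertex G)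
  noDominatingVertex? = all? λ x → any? λ z → ¬? (N₁? x z)

C5-Adj? : ∀ i j → Dec (Adj C5 i j)
C5-Adj? i j = toℕ j ℕ.≟ (toℕ i ℕ.+ 1) ℕ.% 5 ⊎-dec toℕ i ℕ.≟ (toℕ j ℕ.+ 1) ℕ.% 5

C5-twinFree : TwinFree C5
C5-twinFree = from-yes (twinFree? C5 C5-Adj?)

C5-noDominatingVertex : NoDominatingVertex C5
C5-noDominatingVertex = from-yes (noDominatingVertex? C5 C5-Adj?)

C5-power-twinFree×noDominatingVertex : ∀ n .{{_ : NonZero n}} → TwinFree (C5-power n) × NoDominatingVertex (C5-power n)
C5-power-twinFree×noDominatingVertex 1 = C5-twinFree , C5-noDominatingVertex
C5-power-twinFree×noDominatingVertex (suc (suc n)) =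
  let twinFree , noDom = C5-power-twinFree×noDominatingVertex (suc n)
      open ComplementaryProduct (C5-power (suc n)) C5
  in twinFree-×̄ noDom C5-noDominatingVertex twinFree C5-twinFree ,
     noDominatingVertex-×̄ noDom C5-noDominatingVertex

mainTheorem2 : (H : Graph) →
    ((Σ ℕ λ n → Σ (NonZero n) λ nz → C5-power n {{nz}} ≅ H) × (Σ Graph λ R → Reseminant R × R ≅ H)) ⇔ (H ≅ C5)
mainTheorem2 H = mk⇔ onlyC5 (λ H≅C5 → (1 , _ , ≅-sym H≅C5) , (C5 , base , ≅-sym H≅C5))
  where
  onlyC5 : ((Σ ℕ λ n → Σ (NonZero n) λ nz → C5-power n {{nz}} ≅ H) × (Σ Graph λ R → Reseminant R × R ≅ H)) → H ≅ C5
  onlyC5 (_ , (_ , base , C5≅H)) = ≅-sym C5≅H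
  onlyC5 ((n , nz , power≅H) , (_ , dup {G} _ w , R≅H)) =
    ⊥-elim (¬twinFree-duplicate G w
      (twinFree-≅ (≅-sym R≅H) (twinFree-≅ power≅H (proj₁ (C5-power-twinFree×noDominatingVertex n {{nz}})))))
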